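{- Let $\Gamma$ be an equality language that is positive but not negative. Then the relation $\{(x,y,u,v)\in\mathbb{N}^4: x=y\vee u=v\}$ is definable over $\Gamma$ by a quantified conjunctive formula.
   Context: An equality language is a finite set of relations over $\mathbb{N}$ each first-order definable in $(\mathbb{N};=)$, hence definable by a CNF with literals $x=y$, $x\neq y$. A relation is negative if it has a CNF definition whose clauses are single equalities or disjunctions of disequalities; positive if it has a CNF definition with only equality literals; $\Gamma$ is negative/positive if all its relations are. A quantified conjunctive formula over $\Gamma$ is built from atoms over $\Gamma$ (and equalities) using conjunction, existential and universal quantification. -}

module Defs where

open import Data.Nat using (ℕ; suc)
open import Data.Fin using (Fin; zero; suc)
open import Data.List using (List; length; lookup)
open import Data.List.Relation.Unary.All using (All)
open import Data.List.Relation.Unary.Any using (Any)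
open import Data.Product using (Σ; ∃; _×_; _,_; proj₁; proj₂)
open import Data.Sum using (_⊎_)
open import Relation.Binary.PropositionalEquality using (_≡_; _≢_)
open import Relation.Nullary using (¬_)
open import Function.Bundles using (_⇔_)

Rel : ℕ → Set₁
Rel n = (Fin n → ℕ) → Set

data Literal (n : ℕ) : Set where
  eqL  : Fin n → Fin n → Literal n
  neqL : Fin n → Fin n → Literal n

Clause : ℕ → Set
Clause n = List (Literal n)

CNF : ℕ → Set
CNF n = List (Clause n)

⟦_⟧L : ∀ {n} → Literal n → (Fin n → ℕ) → Set
⟦ eqL i j ⟧L a = a i ≡ a j
⟦ neqL i j ⟧L a = a i ≢ a j

⟦_⟧C : ∀ {n} → Clause n → (Fin n → ℕ) → Set
⟦ c ⟧C a = Any (λ l → ⟦ l ⟧L a) c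

⟦_⟧CNF : ∀ {n} → CNF n → (Fin n → ℕ) → Set
⟦ φ ⟧CNF a = All (λ c → ⟦ c ⟧C a) φ

Defines : ∀ {n} → CNF n → Rel n → Set
Defines φ R = ∀ a → (⟦ φ ⟧CNF a ⇔ R a)

IsEqLit : ∀ {n} → Literal n → Set
IsEqLit l = ∃ λ i → ∃ λ j → l ≡ eqL i j

IsNeqLit : ∀ {n} → Literal n → Set
IsNeqLit l = ∃ λ i → ∃ λ j → l ≡ neqL i j

PositiveCNF : ∀ {n} → CNF n → Set
PositiveCNF φ = All (All IsEqLit) φ

NegativeClause : ∀ {n} → Clause n → Set
NegativeClause c = (∃ λ i → ∃ λ j → c ≡ Data.List.[ eqL i j ]) ⊎ All IsNeqLit c

NegativeCNF : ∀ {n} → CNF n → Set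
NegativeCNF φ = All NegativeClause φ

EqualityRel : ∀ {n} → Rel n → Set
EqualityRel {n} R = Σ (CNF n) λ φ → Defines φ R

PositiveRel : ∀ {n} → Rel n → Set
PositiveRel {n} R = Σ (CNF n) λ φ → PositiveCNF φ × Defines φ R

NegativeRel : ∀ {n} → Rel n → Set
NegativeRel {n} R = Σ (CNF n) λ φ → NegativeCNF φ × Defines φ R

Language : Set₁
Language = List (Σ ℕ Rel)

arity : (Γ : Language) → Fin (length Γ) → ℕ
arity Γ r = proj₁ (lookup Γ r)

relOf : (Γ : Language) → (r : Fin (length Γ)) → Rel (arity Γ r)
relOf Γ r = proj₂ (lookup Γ r)

IsEqualityLanguage : Language → Set₁
IsEqualityLanguage Γ = All (λ p → EqualityRel (proj₂ p)) Γ

PositiveLang : Language → Set₁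
PositiveLang Γ = All (λ p → PositiveRel (proj₂ p)) Γ

NegativeLang : Language → Set₁
NegativeLang Γ = All (λ p → NegativeRel (proj₂ p)) Γ

-- Quantified conjunctive formulas over Γ with k free variables (de Bruijn)

data QCF (Γ : Language) : ℕ → Set where
  atom : ∀ {k} (r : Fin (length Γ)) → (Fin (arity Γ r) → Fin k) → QCF Γ k
  equ  : ∀ {k} → Fin k → Fin k → QCF Γ k
  _∧_  : ∀ {k} → QCF Γ k → QCF Γ k → QCF Γ k
  ex   : ∀ {k} → QCF Γ (suc k) → QCF Γ k
  all  : ∀ {k} → QCF Γ (suc k) → QCF Γ k

extend : ∀ {k} → ℕ → (Fin k → ℕ) → Fin (suc k) → ℕ
extend x a zero = x
extend x a (suc i) = a i

⟦_⟧Q : ∀ {Γ k} → QCF Γ k → (Fin k → ℕ) → Set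
⟦_⟧Q {Γ} (atom r σ) a = relOf Γ r (λ i → a (σ i))
⟦ equ i j ⟧Q a = a i ≡ a j
⟦ φ ∧ ψ ⟧Q a = ⟦ φ ⟧Q a × ⟦ ψ ⟧Q a
⟦ ex φ ⟧Q a = Σ ℕ λ x → ⟦ φ ⟧Q (extend x a)
⟦ all φ ⟧Q a = (x : ℕ) → ⟦ φ ⟧Q (extend x a)

QCFDefinable : ∀ {k} → (Γ : Language) → Rel k → Set
QCFDefinable {k} Γ R = Σ (QCF Γ k) λ φ → ∀ a → (⟦ φ ⟧Q a ⇔ R a)

OrEq : Rel 4
OrEq a = a zero ≡ a (suc zero) ⊎ a (suc (suc zero)) ≡ a (suc (suc (suc zero)))

-- A positive relation is one closed under merging coordinates (coarsening the kernel of a tuple),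
-- and such a relation is negative exactly when it is empty or principal: all of its tuples coarsen a
-- single generator. Quantifiers and identifications of coordinates preserve up-closure, so by
-- induction on the arity every relation definable over Γ is principal unless some definable ternary
-- T has T(p,q,p) and T(p,q,q) but no injective triple. Up to arity three this is a finite check.
-- For larger arity, apply the induction hypothesis to ∃x_k R: a repeated entry in its generator is an equality
-- R forces, a new witness is an injective tuple of R, and an old one is an "atom" of R, a tuple whose
-- only identification is one pair. Two atoms on pairs sharing at most one coordinate make ∀x_k R,
-- for k outside both, principal with an injective generator, so R contains an injective tuple. If
-- no base relation is negative we get T, and reading T(p,q,r) as r ∈ {p,q},
-- x = y ∨ u = v is ∃a ∀b ∃c. T(x,c,a) ∧ T(y,c,a) ∧ T(u,b,c) ∧ T(v,b,c).

module Submission where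

open import Defs

open import Data.Nat using (ℕ; zero; suc; _+_; _<_)
import Data.Nat.Properties as ℕ
open import Data.Fin using (Fin; zero; suc; toℕ; punchIn; _≟_; #_)
open import Data.Fin.Properties using (punchIn-punchOut; punchInᵢ≢i; punchIn-injective; toℕ-injective; all?; any?; ∀-cons)
open import Data.List using ([]; length; concat; tabulate; [_])
open import Data.List.Properties using (tabulate-lookup)
open import Data.List.Membership.Propositional.Properties using (∈-lookup)
open import Data.List.Relation.Unary.All as All using (All; _∷_; [])
open import Data.List.Relation.Unary.All.Properties using (concat⁺; concat⁻; tabulate⁺; tabulate⁻)
open import Data.List.Relation.Unary.Any as Any using (here; there)
open import Data.List.Relation.Unary.Any.Properties using (singleton⁻)
open import Data.Vec using (_∷_; []; lookup)
open import Data.Vec.Functional using (insertAt; removeAt)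
open import Data.Vec.Functional.Properties using (insertAt-lookup; insertAt-punchIn; insertAt-removeAt; removeAt-insertAt)
open import Data.Product using (Σ; ∃; ∃₂; _×_; _,_; proj₁; proj₂; map₂)
open import Data.Sum as Sum using (_⊎_; inj₁; inj₂; [_,_]′; fromInj₁)
open import Data.Empty using (⊥-elim)
open import Function using (_∘_; _$_; const; id)
open import Function.Definitions using (Injective)
open import Function.Bundles using (_⇔_; mk⇔; Equivalence)
open import Function.Properties.Equivalence using () renaming (trans to ⇔-trans; sym to ⇔-sym)
open import Level using (0ℓ)
open import Relation.Binary.PropositionalEquality using (_≡_; _≢_; refl; sym; trans; cong; subst; _≗_)
open import Relation.Nullary using (¬_; ¬?; Dec; yes; no; _→-dec_; _×-dec_; _⊎-dec_; contradiction)
open import Relation.Nullary.Decidable using (True; toWitness; decidable-stable; map′)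
open import Relation.Unary using (Pred; Decidable; Empty; ｛_｝; _∪_; _∩_; _∉_; _⊆_)
open import Relation.Unary.Properties using (_∪?_)

private
  variable
    n m : ℕ

-- Kernels of tuples

Tuple : ℕ → Set
Tuple n = Fin n → ℕ

⟨_,_,_⟩ : ∀ {ℓ} {A : Set ℓ} → A → A → A → Fin 3 → A
⟨ x , y , z ⟩ zero = x
⟨ x , y , z ⟩ (suc zero) = y
⟨ x , y , z ⟩ (suc (suc zero)) = z

∘-⟨⟩ : ∀ {A B : Set} (f : A → B) (x y z : A) → f ∘ ⟨ x , y , z ⟩ ≗ ⟨ f x , f y , f z ⟩
∘-⟨⟩ f x y z zero = refl
∘-⟨⟩ f x y z (suc zero) = refl
∘-⟨⟩ f x y z (suc (suc zero)) = refl

private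
  variable
    a b g h : Tuple n
    S T : Pred (Fin n) 0ℓ

infix 4 _⊑_ _⊑?_
_⊑_ : Tuple n → Tuple n → Set
a ⊑ b = ∀ i j → a i ≡ a j → b i ≡ b j

⊑-refl : a ⊑ a
⊑-refl i j e = e

⊑-trans : a ⊑ b → b ⊑ h → a ⊑ h
⊑-trans a⊑b b⊑h i j = b⊑h i j ∘ a⊑b i j

≗⇒⊑ : a ≗ b → a ⊑ b
≗⇒⊑ a≗b i j e = trans (sym (a≗b i)) (trans e (a≗b j))

⊑-∘ : (μ : Fin m → Fin n) → a ⊑ b → a ∘ μ ⊑ b ∘ μ
⊑-∘ μ a⊑b i j = a⊑b (μ i) (μ j)

⊑-injective : a ⊑ b → Injective _≡_ _≡_ b → Injective _≡_ _≡_ a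
⊑-injective a⊑b b-inj {i} {j} = b-inj ∘ a⊑b i j

injective⇒⊑ : Injective _≡_ _≡_ a → a ⊑ b
injective⇒⊑ {b = b} a-inj i j e = cong b (a-inj e)

_⊑?_ : (a b : Tuple n) → Dec (a ⊑ b)
a ⊑? b = all? λ i → all? λ j → (a i ℕ.≟ a j) →-dec (b i ℕ.≟ b j)

⊑-by-decision : {a b : Tuple n} → {True (a ⊑? b)} → a ⊑ b
⊑-by-decision {a = a} {b} {t} = toWitness {a? = a ⊑? b} t

injective-or-duplicate : (g : Tuple n) → Injective _≡_ _≡_ g ⊎ ∃₂ λ i j → i ≢ j × g i ≡ g j
injective-or-duplicate g with any? (λ i → any? λ j → ¬? (i ≟ j) ×-dec (g i ℕ.≟ g j))
... | yes (i , j , i≢j , e) = inj₂ (i , j , i≢j , e)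
... | no none = inj₁ λ {i} {j} e → decidable-stable (i ≟ j) λ i≢j → none (i , j , i≢j , e)

transfer-value : a ⊑ b → (z : ℕ) → ∃ λ z′ → ∀ m → a m ≡ z → b m ≡ z′
transfer-value {a = a} {b} a⊑b z with any? (λ m → a m ℕ.≟ z)
... | yes (m , am≡z) = b m , λ m′ e → a⊑b m′ m (trans e (sym am≡z))
... | no z∉a = 0 , λ m e → contradiction (m , e) z∉a

MergesWithin : Tuple n → Pred (Fin n) 0ℓ → Set
MergesWithin h S = ∀ i j → h i ≡ h j → i ≡ j ⊎ (S i × S j)

mergesWithin-⊑ : g ⊑ h → MergesWithin h S → MergesWithin g S
mergesWithin-⊑ g⊑h merges i j = merges i j ∘ g⊑h i j

mergesWithin-∩ : MergesWithin h S → MergesWithin h T → MergesWithin h (S ∩ T)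
mergesWithin-∩ mS mT i j e with mS i j e | mT i j e
... | inj₁ i≡j | _ = inj₁ i≡j
... | inj₂ _ | inj₁ i≡j = inj₁ i≡j
... | inj₂ (Si , Sj) | inj₂ (Ti , Tj) = inj₂ ((Si , Ti) , (Sj , Tj))

mergesWithin-⊆ : S ⊆ T → MergesWithin h S → MergesWithin h T
mergesWithin-⊆ S⊆T merges i j e with merges i j e
... | inj₁ i≡j = inj₁ i≡j
... | inj₂ (Si , Sj) = inj₂ (S⊆T Si , S⊆T Sj)

mergesWithin⇒⊑ : MergesWithin h S → (∀ {i j} → S i → S j → b i ≡ b j) → h ⊑ b
mergesWithin⇒⊑ merges b-const i j e with merges i j e
... | inj₁ refl = refl
... | inj₂ (Si , Sj) = b-const Si Sj

mergesWithin⇒injective : MergesWithin h S → (∀ {i j} → S i → S j → i ≡ j) → Injective _≡_ _≡_ h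
mergesWithin⇒injective merges atMostOne {i} {j} e with merges i j e
... | inj₁ i≡j = i≡j
... | inj₂ (Si , Sj) = atMostOne Si Sj

Pair : Fin n → Fin n → Pred (Fin n) 0ℓ
Pair x y = ｛ x ｝ ∪ ｛ y ｝

pair? : (x y : Fin n) → Decidable (Pair x y)
pair? x y = (x ≟_) ∪? (y ≟_)

pair-∩-atMostOne : ∀ {x y u v i j : Fin n} → u ∉ Pair x y →
                   (Pair x y ∩ Pair u v) i → (Pair x y ∩ Pair u v) j → i ≡ j
pair-∩-atMostOne u∉xy i∈ j∈ = trans (sym (is-v u∉xy i∈)) (is-v u∉xy j∈)
  where
    is-v : ∀ {x y u v i : Fin n} → u ∉ Pair x y → (Pair x y ∩ Pair u v) i → v ≡ i
    is-v u∉xy (i∈xy , inj₁ refl) = contradiction i∈xy u∉xy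
    is-v u∉xy (_ , inj₂ v≡i) = v≡i

collapse : {S : Pred (Fin n) 0ℓ} → Decidable S → Tuple n
collapse S? i with S? i
... | yes _ = 0
... | no _ = suc (toℕ i)

collapse-∈ : {S : Pred (Fin n) 0ℓ} (S? : Decidable S) {i : Fin n} → S i → collapse S? i ≡ 0
collapse-∈ S? {i} Si with S? i
... | yes _ = refl
... | no ¬Si = contradiction Si ¬Si

collapse-const : {S : Pred (Fin n) 0ℓ} (S? : Decidable S) {i j : Fin n} → S i → S j → collapse S? i ≡ collapse S? j
collapse-const S? Si Sj = trans (collapse-∈ S? Si) (sym (collapse-∈ S? Sj))

collapse-mergesWithin : {S : Pred (Fin n) 0ℓ} (S? : Decidable S) → MergesWithin (collapse S?) S
collapse-mergesWithin S? i j e with S? i | S? j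
... | yes Si | yes Sj = inj₂ (Si , Sj)
... | yes _ | no _ = contradiction e (ℕ.0≢1+n)
... | no _ | yes _ = contradiction (sym e) ℕ.0≢1+n
... | no _ | no _ = inj₁ (toℕ-injective (ℕ.suc-injective e))

data InsertView (k : Fin (suc n)) : Fin (suc n) → Set where
  at      : InsertView k k
  punched : (j : Fin n) → InsertView k (punchIn k j)

insertView : (k i : Fin (suc n)) → InsertView k i
insertView k i with i ≟ k
... | yes refl = at
... | no i≢k = subst (InsertView k) (punchIn-punchOut (i≢k ∘ sym)) (punched _)

module _ (k : Fin (suc n)) {z : ℕ} where

  insertAt-⊑ : {a : Tuple n} {c : Tuple (suc n)} → a ⊑ removeAt c k →
               (∀ m → a m ≡ z → c (punchIn k m) ≡ c k) → insertAt a k z ⊑ c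
  insertAt-⊑ {a} {c} a⊑c hz i j with insertView k i | insertView k j
  ... | at | at = λ _ → refl
  ... | at | punched m rewrite insertAt-lookup a k z | insertAt-punchIn a k z m = λ e → sym (hz m (sym e))
  ... | punched m | at rewrite insertAt-lookup a k z | insertAt-punchIn a k z m = hz m
  ... | punched m | punched m′ rewrite insertAt-punchIn a k z m | insertAt-punchIn a k z m′ = a⊑c m m′

  insertAt-mono : ∀ {z′} → a ⊑ b → (∀ m → a m ≡ z → b m ≡ z′) → insertAt a k z ⊑ insertAt b k z′
  insertAt-mono {b = b} {z′} a⊑b hz = insertAt-⊑ (⊑-trans a⊑b (≗⇒⊑ (sym ∘ removeAt-insertAt b k z′)))
    λ m e → trans (insertAt-punchIn b k z′ m) (trans (hz m e) (sym (insertAt-lookup b k z′)))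

  insertAt-mergesWithin : Injective _≡_ _≡_ g → S k → (∀ m → g m ≡ z → S (punchIn k m)) →
                          MergesWithin (insertAt g k z) S
  insertAt-mergesWithin {g = g} g-inj Sk hz i j with insertView k i | insertView k j
  ... | at | at = λ _ → inj₁ refl
  ... | at | punched m rewrite insertAt-lookup g k z | insertAt-punchIn g k z m = λ e → inj₂ (Sk , hz m (sym e))
  ... | punched m | at rewrite insertAt-lookup g k z | insertAt-punchIn g k z m = λ e → inj₂ (hz m e , Sk)
  ... | punched m | punched m′ rewrite insertAt-punchIn g k z m | insertAt-punchIn g k z m′ =
    λ e → inj₁ (cong (punchIn k) (g-inj e))

  insertAt-injective : Injective _≡_ _≡_ g → (∀ m → g m ≢ z) → Injective _≡_ _≡_ (insertAt g k z)
  insertAt-injective g-inj z-new =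
    mergesWithin⇒injective (insertAt-mergesWithin g-inj refl λ m e → contradiction e (z-new m))
                           λ k≡i k≡j → trans (sym k≡i) k≡j

  insertAt-removeAt-≢ : (h : Tuple (suc n)) {i : Fin (suc n)} → i ≢ k → insertAt (removeAt h k) k z i ≡ h i
  insertAt-removeAt-≢ h {i} i≢k with insertView k i
  ... | at = contradiction refl i≢k
  ... | punched m = insertAt-punchIn (removeAt h k) k z m

  ⊑-insertAt-removeAt : MergesWithin h S → k ∉ S → h ⊑ insertAt (removeAt h k) k z
  ⊑-insertAt-removeAt {h = h} merges k∉S i j e with merges i j e
  ... | inj₁ refl = refl
  ... | inj₂ (Si , Sj) = trans (insertAt-removeAt-≢ h (λ { refl → k∉S Si }))
                               (trans e (sym (insertAt-removeAt-≢ h (λ { refl → k∉S Sj }))))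

map-insertAt : {A B : Set} (f : A → B) (xs : Fin n → A) (k : Fin (suc n)) (z : A) →
               f ∘ insertAt xs k z ≗ insertAt (f ∘ xs) k (f z)
map-insertAt f xs k z i with insertView k i
... | at rewrite insertAt-lookup xs k z | insertAt-lookup (f ∘ xs) k (f z) = refl
... | punched m rewrite insertAt-punchIn xs k z m | insertAt-punchIn (f ∘ xs) k (f z) m = refl

removeAt-mergesWithin : (k : Fin (suc n)) → MergesWithin h S → MergesWithin (removeAt h k) (S ∘ punchIn k)
removeAt-mergesWithin k merges i j e with merges (punchIn k i) (punchIn k j) e
... | inj₁ eq = inj₁ (punchIn-injective k i j eq)
... | inj₂ S-both = inj₂ S-both

fresh : Tuple n → ℕ
fresh {zero} _ = 0
fresh {suc n} b = suc (b zero) + fresh (b ∘ suc)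

<fresh : (b : Tuple n) (i : Fin n) → b i < fresh b
<fresh b zero = ℕ.m≤m+n (suc (b zero)) _
<fresh b (suc i) = ℕ.<-≤-trans (<fresh (b ∘ suc) i) (ℕ.m≤n+m _ (suc (b zero)))

fresh-≢ : (b : Tuple n) (i : Fin n) → b i ≢ fresh b
fresh-≢ b i = ℕ.<⇒≢ (<fresh b i)

insertAt-fresh-⊑ : (k : Fin (suc n)) {z : ℕ} → a ⊑ b → insertAt a k (fresh a) ⊑ insertAt b k z
insertAt-fresh-⊑ {a = a} k a⊑b = insertAt-mono k a⊑b λ m e → contradiction e (fresh-≢ a m)

-- Up-closed relations

-- Decidability is carried along so that membership of the finitely many kernel shapes can be tested.
record UpRel (n : ℕ) : Set₁ where
  field
    holds  : Tuple n → Set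
    mono   : a ⊑ b → holds a → holds b
    holds? : Decidable holds

open UpRel public

private
  variable
    R : UpRel n

holds-≗ : (R : UpRel n) → a ≗ b → holds R a → holds R b
holds-≗ R = mono R ∘ ≗⇒⊑

holds-⇔ : (R : UpRel n) → a ≗ b → holds R a ⇔ holds R b
holds-⇔ R a≗b = mk⇔ (holds-≗ R a≗b) (holds-≗ R (sym ∘ a≗b))

reindex : (Fin m → Fin n) → UpRel m → UpRel n
reindex μ R = record
  { holds  = λ b → holds R (b ∘ μ)
  ; mono   = mono R ∘ ⊑-∘ μ
  ; holds? = λ b → holds? R (b ∘ μ)
  }

project∃ : Fin (suc n) → UpRel (suc n) → UpRel n
project∃ {n} k R = record { holds = Holds ; mono = mono′ ; holds? = holds?′ }
  where
    Holds : Tuple n → Set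
    Holds b = ∃ λ z → holds R (insertAt b k z)

    mono′ : a ⊑ b → Holds a → Holds b
    mono′ a⊑b (z , r) with transfer-value a⊑b z
    ... | z′ , hz = z′ , mono R (insertAt-mono k a⊑b hz) r

    -- up to ⊑, the only witnesses are the entries of b and one fresh value
    canonical-witness : ∀ {b z} → holds R (insertAt b k z) →
                        (∃ λ m → holds R (insertAt b k (b m))) ⊎ holds R (insertAt b k (fresh b))
    canonical-witness {b} {z} r with any? (λ m → b m ℕ.≟ z)
    ... | yes (m , refl) = inj₁ (m , r)
    ... | no z∉b = inj₂ (mono R (insertAt-mono k ⊑-refl λ m e → contradiction (m , e) z∉b) r)

    holds?′ : Decidable Holds
    holds?′ b = map′ [ (λ (m , r) → b m , r) , (fresh b ,_) ]′ (canonical-witness ∘ proj₂)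
                     (any? (λ m → holds? R (insertAt b k (b m))) ⊎-dec holds? R (insertAt b k (fresh b)))

project∀ : Fin (suc n) → UpRel (suc n) → UpRel n
project∀ {n} k R = record
  { holds  = Holds
  ; mono   = λ a⊑b r z → mono R (insertAt-fresh-⊑ k a⊑b) (r _)
  ; holds? = λ b → map′ (λ r z → mono R (insertAt-fresh-⊑ k ⊑-refl) r) (λ r → r (fresh b))
                        (holds? R (insertAt b k (fresh b)))
  }
  where
    Holds : Tuple n → Set
    Holds b = ∀ z → holds R (insertAt b k z)

data Principal (R : UpRel n) : Set where
  empty     : (∀ b → ¬ holds R b) → Principal R
  generated : (g : Tuple n) → holds R g → (∀ {b} → holds R b → g ⊑ b) → Principal R

injective⇒principal : holds R h → Injective _≡_ _≡_ h → Principal R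
injective⇒principal r h-inj = generated _ r λ _ → injective⇒⊑ h-inj

principal-meet : Principal R → holds R a → holds R b → ∃ λ g → holds R g × g ⊑ a × g ⊑ b
principal-meet (empty none) ra _ = contradiction ra (none _)
principal-meet (generated g rg least) ra rb = g , rg , least ra , least rb

removeAt-∈-project∃ : (R : UpRel (suc n)) (k : Fin (suc n)) → holds R b → holds (project∃ k R) (removeAt b k)
removeAt-∈-project∃ {b = b} R k r = b k , holds-≗ R (sym ∘ insertAt-removeAt b k) r

removeAt-∈-project∀ : (R : UpRel (suc n)) (k : Fin (suc n)) → holds R h → MergesWithin h S → k ∉ S →
                      holds (project∀ k R) (removeAt h k)
removeAt-∈-project∀ R k r merges k∉S z = mono R (⊑-insertAt-removeAt k merges k∉S) r

project∃-empty : (R : UpRel (suc n)) (k : Fin (suc n)) → (∀ b → ¬ holds (project∃ k R) b) → ∀ b → ¬ holds R b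
project∃-empty R k none b r = none _ (removeAt-∈-project∃ R k r)

-- R is its projection along k with coordinate k re-inserted as a copy of coordinate i.
forced-equality⇒principal : (R : UpRel (suc n)) {i k : Fin (suc n)} → i ≢ k →
                            (∀ {b} → holds R b → b i ≡ b k) →
                            Principal (project∃ k R) → Principal R
forced-equality⇒principal R {i} {k} i≢k forced p with insertView k i
... | at = contradiction refl i≢k
... | punched i′ with p
...   | empty none = empty (project∃-empty R k none)
...   | generated h (z , rz) least = generated (insertAt h k z) rz λ rb →
  let h⊑b = least (removeAt-∈-project∃ R k rb) in
  insertAt-⊑ k h⊑b λ m hm≡z → trans (h⊑b m i′ (trans hm≡z (sym hi′≡z))) (forced rb)
  where
    hi′≡z : h i′ ≡ z
    hi′≡z = trans (sym (insertAt-punchIn h k z i′)) (trans (forced rz) (insertAt-lookup h k z))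

HoldsMergingWithin : UpRel n → Pred (Fin n) 0ℓ → Set
HoldsMergingWithin R S = ∃ λ h → holds R h × MergesWithin h S

holdsMergingWithin⇒holds : (R : UpRel n) → HoldsMergingWithin R S → (∀ {i j} → S i → S j → b i ≡ b j) → holds R b
holdsMergingWithin⇒holds R (h , r , merges) b-const = mono R (mergesWithin⇒⊑ merges b-const) r

empty-unless-constant : (R : UpRel n) → ¬ holds R (const 0) → ∀ b → ¬ holds R b
empty-unless-constant R ¬r b r = ¬r (mono R (λ _ _ _ → refl) r)

principal-of-arity≤1 : (∀ (i j : Fin n) → i ≡ j) → (R : UpRel n) → Principal R
principal-of-arity≤1 trivial R with holds? R (const 0)
... | yes r = injective⇒principal r λ {i} {j} _ → trivial i j
... | no ¬r = empty (empty-unless-constant R ¬r)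

⊑² : {a b : Tuple 2} → (a zero ≡ a (suc zero) → b zero ≡ b (suc zero)) → a ⊑ b
⊑² h zero zero _ = refl
⊑² h zero (suc zero) e = h e
⊑² h (suc zero) zero e = sym (h (sym e))
⊑² h (suc zero) (suc zero) _ = refl

principal₂ : (R : UpRel 2) → Principal R
principal₂ R with holds? R toℕ | holds? R (const 0)
... | yes r | _ = injective⇒principal r toℕ-injective
... | no _ | no ¬r = empty (empty-unless-constant R ¬r)
... | no ¬r01 | yes r = generated (const 0) r λ {b} rb → ⊑² λ _ →
  decidable-stable (b zero ℕ.≟ b (suc zero)) λ b₀≢b₁ → ¬r01 (mono R (⊑² λ e → contradiction e b₀≢b₁) rb)

⊑³ : {a b : Tuple 3} → (a (# 0) ≡ a (# 1) → b (# 0) ≡ b (# 1)) → (a (# 0) ≡ a (# 2) → b (# 0) ≡ b (# 2)) →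
     (a (# 1) ≡ a (# 2) → b (# 1) ≡ b (# 2)) → a ⊑ b
⊑³ h₀₁ h₀₂ h₁₂ zero zero _ = refl
⊑³ h₀₁ h₀₂ h₁₂ zero (suc zero) = h₀₁
⊑³ h₀₁ h₀₂ h₁₂ zero (suc (suc zero)) = h₀₂
⊑³ h₀₁ h₀₂ h₁₂ (suc zero) zero e = sym (h₀₁ (sym e))
⊑³ h₀₁ h₀₂ h₁₂ (suc zero) (suc zero) _ = refl
⊑³ h₀₁ h₀₂ h₁₂ (suc zero) (suc (suc zero)) = h₁₂
⊑³ h₀₁ h₀₂ h₁₂ (suc (suc zero)) zero e = sym (h₀₂ (sym e))
⊑³ h₀₁ h₀₂ h₁₂ (suc (suc zero)) (suc zero) e = sym (h₁₂ (sym e))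
⊑³ h₀₁ h₀₂ h₁₂ (suc (suc zero)) (suc (suc zero)) _ = refl

data Shape₃ : Set where
  s000 s001 s010 s011 s012 : Shape₃

shape : Shape₃ → Tuple 3
shape s000 = const 0
shape s001 = ⟨ 0 , 0 , 1 ⟩
shape s010 = ⟨ 0 , 1 , 0 ⟩
shape s011 = ⟨ 0 , 1 , 1 ⟩
shape s012 = ⟨ 0 , 1 , 2 ⟩

shapeOf : (b : Tuple 3) → ∃ λ s → b ⊑ shape s × shape s ⊑ b
shapeOf b with b (# 0) ℕ.≟ b (# 1) | b (# 0) ℕ.≟ b (# 2) | b (# 1) ℕ.≟ b (# 2)
... | yes e₀₁ | yes e₀₂ | _ =
  s000 , (λ _ _ _ → refl) , ⊑³ (λ _ → e₀₁) (λ _ → e₀₂) (λ _ → trans (sym e₀₁) e₀₂)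
... | yes e₀₁ | no n₀₂ | _ =
  s001 , ⊑³ (λ _ → refl) (⊥-elim ∘ n₀₂) (⊥-elim ∘ n₀₂ ∘ trans e₀₁) , ⊑³ (λ _ → e₀₁) (λ ()) (λ ())
... | no n₀₁ | yes e₀₂ | _ =
  s010 , ⊑³ (⊥-elim ∘ n₀₁) (λ _ → refl) (⊥-elim ∘ n₀₁ ∘ trans e₀₂ ∘ sym) , ⊑³ (λ ()) (λ _ → e₀₂) (λ ())
... | no n₀₁ | no n₀₂ | yes e₁₂ =
  s011 , ⊑³ (⊥-elim ∘ n₀₁) (⊥-elim ∘ n₀₂) (λ _ → refl) , ⊑³ (λ ()) (λ ()) (λ _ → e₁₂)
... | no n₀₁ | no n₀₂ | no n₁₂ =
  s012 , ⊑³ (⊥-elim ∘ n₀₁) (⊥-elim ∘ n₀₂) (⊥-elim ∘ n₁₂) , ⊑³ (λ ()) (λ ()) (λ ())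

generated-by-shape : (R : UpRel 3) (s : Shape₃) → holds R (shape s) →
                     (∀ t → holds R (shape t) → shape s ⊑ shape t) → Principal R
generated-by-shape R s r least = generated (shape s) r λ {b} rb →
  let t , b⊑t , t⊑b = shapeOf b in ⊑-trans (least t (mono R b⊑t rb)) t⊑b

record IsSelector (T : UpRel 3) : Set where
  field
    holds-010  : holds T ⟨ 0 , 1 , 0 ⟩
    holds-011  : holds T ⟨ 0 , 1 , 1 ⟩
    ¬holds-012 : ¬ holds T ⟨ 0 , 1 , 2 ⟩

-- The dichotomy

identify : Fin n → Fin (suc n) → Fin n
identify c zero = c
identify c (suc i) = i

identify-≗ : (c : Fin n) {v : Tuple (suc n)} → v zero ≡ v (suc c) → (v ∘ suc) ∘ identify c ≗ v
identify-≗ c e zero = sym e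
identify-≗ c e (suc i) = refl

-- Merging coordinates 0 and c+1 in the two atoms gives two tuples of the principal relation
-- R[x₀ = x_{c+1}]; its generator lies below both, so it merges at most 0 and c+1.
merge-atoms : (R : UpRel (suc n)) (c : Fin n) → Principal (reindex (identify c) R) →
              {S₁ S₂ : Pred (Fin (suc n)) 0ℓ} → Decidable S₁ → Decidable S₂ → Empty (S₁ ∩ S₂) →
              HoldsMergingWithin R S₁ → HoldsMergingWithin R S₂ → HoldsMergingWithin R (Pair (suc c) zero)
merge-atoms {n} R c p {S₁} {S₂} S₁? S₂? disjoint hm₁ hm₂ =
  let g , rg , g⊑₁ , g⊑₂ = principal-meet p (identified S₁? hm₁) (identified S₂? hm₂) in
  g ∘ identify c , rg , mergesWithin-⊆ only-pair (mergesWithin-∩ (within S₁? g⊑₁) (within S₂? g⊑₂))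
  where
    P : Pred (Fin (suc n)) 0ℓ
    P = Pair (suc c) zero

    P? : Decidable P
    P? = pair? (suc c) zero

    collapse-with-P : {S : Pred (Fin (suc n)) 0ℓ} → Decidable S → Tuple (suc n)
    collapse-with-P S? = collapse (S? ∪? P?)

    collapse-with-P-≗ : {S : Pred (Fin (suc n)) 0ℓ} (S? : Decidable S) →
                        (collapse-with-P S? ∘ suc) ∘ identify c ≗ collapse-with-P S?
    collapse-with-P-≗ S? = identify-≗ c (collapse-const (S? ∪? P?) (inj₂ (inj₂ refl)) (inj₂ (inj₁ refl)))

    identified : {S : Pred (Fin (suc n)) 0ℓ} (S? : Decidable S) → HoldsMergingWithin R S →
                 holds (reindex (identify c) R) (collapse-with-P S? ∘ suc)
    identified S? hm = holds-≗ R (sym ∘ collapse-with-P-≗ S?)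
      (holdsMergingWithin⇒holds R hm λ Si Sj → collapse-const (S? ∪? P?) (inj₁ Si) (inj₁ Sj))

    within : {S : Pred (Fin (suc n)) 0ℓ} {g : Tuple n} (S? : Decidable S) → g ⊑ collapse-with-P S? ∘ suc →
             MergesWithin (g ∘ identify c) (S ∪ P)
    within S? g⊑ = mergesWithin-⊑ (⊑-trans (⊑-∘ (identify c) g⊑) (≗⇒⊑ (collapse-with-P-≗ S?)))
                                  (collapse-mergesWithin _)

    only-pair : (S₁ ∪ P) ∩ (S₂ ∪ P) ⊆ P
    only-pair (inj₂ Pi , _) = Pi
    only-pair (inj₁ _ , inj₂ Pi) = Pi
    only-pair (inj₁ S₁i , inj₁ S₂i) = contradiction (S₁i , S₂i) (disjoint _)

spare-coordinates : (a : Fin (4 + n)) → ∃₂ λ c k → suc c ∉ Pair zero a × k ∉ Pair zero a × k ≢ suc c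
spare-coordinates a with a ≟ # 1 | a ≟ # 2
... | yes refl | _ = # 1 , # 3 , (λ { (inj₁ ()) ; (inj₂ ()) }) , (λ { (inj₁ ()) ; (inj₂ ()) }) , λ ()
... | no _ | yes refl = # 0 , # 3 , (λ { (inj₁ ()) ; (inj₂ ()) }) , (λ { (inj₁ ()) ; (inj₂ ()) }) , λ ()
... | no a≢1 | no a≢2 = # 0 , # 2 , [ (λ ()) , a≢1 ]′ , [ (λ ()) , a≢2 ]′ , λ ()

module Dichotomy
  (Def             : ∀ {n} → UpRel n → Set)
  (reindex-closed  : ∀ {m n} (μ : Fin m → Fin n) {R : UpRel m} → Def R → Def (reindex μ R))
  (project∃-closed : ∀ {n} (k : Fin (suc n)) {R : UpRel (suc n)} → Def R → Def (project∃ k R))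
  (project∀-closed : ∀ {n} (k : Fin (suc n)) {R : UpRel (suc n)} → Def R → Def (project∀ k R))
  where

  Selector : Set₁
  Selector = ∃ λ (T : UpRel 3) → Def T × IsSelector T

  Dichotomous : UpRel n → Set₁
  Dichotomous R = Selector ⊎ Principal R

  DichotomyAt : ℕ → Set₁
  DichotomyAt n = (R : UpRel n) → Def R → Dichotomous R

  -- Read off the generator of ∃x_k R: a repeated entry is an equality R forces, a new witness an
  -- injective tuple of R, and an old witness an atom at k.
  atom-at : DichotomyAt n → (R : UpRel (suc n)) → Def R → (k : Fin (suc n)) →
            Dichotomous R ⊎ ∃ λ a → a ≢ k × HoldsMergingWithin R (Pair k a)
  atom-at ih R d k with ih (project∃ k R) (project∃-closed k d)
  ... | inj₁ s = inj₁ (inj₁ s)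
  ... | inj₂ (empty none) = inj₁ (inj₂ (empty (project∃-empty R k none)))
  ... | inj₂ (generated g (z , rz) least) with injective-or-duplicate g
  ...   | inj₂ (i , j , i≢j , gi≡gj) = inj₁ (forced (ih (project∃ (punchIn k j) R) (project∃-closed _ d)))
    where
      forced : Dichotomous (project∃ (punchIn k j) R) → Dichotomous R
      forced (inj₁ s) = inj₁ s
      forced (inj₂ p) = inj₂ (forced-equality⇒principal R (i≢j ∘ punchIn-injective k i j)
                                (λ rb → least (removeAt-∈-project∃ R k rb) i j gi≡gj) p)
  ...   | inj₁ g-inj with any? (λ m → g m ℕ.≟ z)
  ...     | no z-new = inj₁ (inj₂ (injective⇒principal rz (insertAt-injective k g-inj λ m e → z-new (m , e))))
  ...     | yes (m , refl) = inj₂ (punchIn k m , punchInᵢ≢i k m , insertAt g k (g m) , rz ,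
                                   insertAt-mergesWithin k g-inj (inj₁ refl) λ m′ e → inj₂ (cong (punchIn k) (g-inj (sym e))))

  -- The generator of ∀x_k R lies below both atoms with x_k removed, so it is injective.
  two-atoms : DichotomyAt n → (R : UpRel (suc n)) → Def R → {S₁ S₂ : Pred (Fin (suc n)) 0ℓ} →
              (k : Fin (suc n)) → k ∉ S₁ → k ∉ S₂ → (∀ {i j} → (S₁ ∩ S₂) i → (S₁ ∩ S₂) j → i ≡ j) →
              HoldsMergingWithin R S₁ → HoldsMergingWithin R S₂ → Dichotomous R
  two-atoms ih R d k k∉S₁ k∉S₂ atMostOne (h₁ , r₁ , m₁) (h₂ , r₂ , m₂) with ih (project∀ k R) (project∀-closed k d)
  ... | inj₁ s = inj₁ s
  ... | inj₂ p =
    let g , rg , g⊑₁ , g⊑₂ = principal-meet p (removeAt-∈-project∀ R k r₁ m₁ k∉S₁) (removeAt-∈-project∀ R k r₂ m₂ k∉S₂)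
        g-inj = mergesWithin⇒injective
                  (mergesWithin-∩ (mergesWithin-⊑ g⊑₁ (removeAt-mergesWithin k m₁))
                                  (mergesWithin-⊑ g⊑₂ (removeAt-mergesWithin k m₂)))
                  λ {i} {j} S-i S-j → punchIn-injective k i j (atMostOne S-i S-j)
    in inj₂ (injective⇒principal (rg (fresh g)) (insertAt-injective k g-inj (fresh-≢ g)))

  -- Take atoms at 0 and at c; if their pairs are disjoint, first merge them (merge-atoms) into the
  -- atom {c, 0}. The spare coordinate k lies outside every pair involved.
  step : DichotomyAt (3 + n) → DichotomyAt (4 + n)
  step ih R d with atom-at ih R d zero
  ... | inj₁ r = r
  ... | inj₂ (a , _ , atom₀) with spare-coordinates a
  ...   | c , k , c∉ , k∉ , k≢c with atom-at ih R d (suc c)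
  ...     | inj₁ r = r
  ...     | inj₂ (a′ , _ , atomc) with pair? zero a a′
  ...       | yes a′∈ = two-atoms ih R d k k∉ [ k≢c ∘ sym , (λ { refl → k∉ a′∈ }) ]′ (pair-∩-atMostOne c∉) atom₀ atomc
  ...       | no a′∉ with ih (reindex (identify c) R) (reindex-closed (identify c) d)
  ...         | inj₁ s = inj₁ s
  ...         | inj₂ p = two-atoms ih R d k k∉ [ k≢c ∘ sym , k∉ ∘ inj₁ ]′ (pair-∩-atMostOne c∉) atom₀
                           (merge-atoms R c p (pair? zero a) (pair? (suc c) a′) disjoint atom₀ atomc)
    where
      disjoint : Empty (Pair zero a ∩ Pair (suc c) a′)
      disjoint _ (i∈ , inj₁ refl) = c∉ i∈
      disjoint _ (i∈ , inj₂ refl) = a′∉ i∈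

  selector-via : (R : UpRel 3) → Def R → (μ : Fin 3 → Fin 3) → holds R (⟨ 0 , 1 , 0 ⟩ ∘ μ) →
                 holds R (⟨ 0 , 1 , 1 ⟩ ∘ μ) → ¬ holds R (⟨ 0 , 1 , 2 ⟩ ∘ μ) → Selector
  selector-via R d μ first second ¬third = reindex μ R , reindex-closed μ d , record
    { holds-010 = first ; holds-011 = second ; ¬holds-012 = ¬third }

  ternary : DichotomyAt 3
  ternary R d with holds? R ⟨ 0 , 1 , 2 ⟩
  ... | yes r012 = inj₂ (injective⇒principal r012 (⊑-injective ⊑-by-decision toℕ-injective))
  ... | no ¬r012 with holds? R ⟨ 0 , 0 , 1 ⟩ | holds? R ⟨ 0 , 1 , 0 ⟩ | holds? R ⟨ 0 , 1 , 1 ⟩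
  ...   | yes r001 | yes r010 | _ = inj₁ (selector-via R d ⟨ # 2 , # 0 , # 1 ⟩
                                         (mono R ⊑-by-decision r001) (mono R ⊑-by-decision r010) (¬r012 ∘ mono R ⊑-by-decision))
  ...   | yes r001 | no _ | yes r011 = inj₁ (selector-via R d ⟨ # 0 , # 2 , # 1 ⟩
                                         (mono R ⊑-by-decision r001) (mono R ⊑-by-decision r011) (¬r012 ∘ mono R ⊑-by-decision))
  ...   | no _ | yes r010 | yes r011 = inj₁ (selector-via R d id r010 r011 ¬r012)
  ...   | yes r001 | no ¬r010 | no ¬r011 = inj₂ (generated-by-shape R s001 r001 λ
    { s000 _ → ⊑-by-decision ; s001 _ → ⊑-refl ; s010 → ⊥-elim ∘ ¬r010 ; s011 → ⊥-elim ∘ ¬r011 ; s012 → ⊥-elim ∘ ¬r012 })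
  ...   | no ¬r001 | yes r010 | no ¬r011 = inj₂ (generated-by-shape R s010 r010 λ
    { s000 _ → ⊑-by-decision ; s001 → ⊥-elim ∘ ¬r001 ; s010 _ → ⊑-refl ; s011 → ⊥-elim ∘ ¬r011 ; s012 → ⊥-elim ∘ ¬r012 })
  ...   | no ¬r001 | no ¬r010 | yes r011 = inj₂ (generated-by-shape R s011 r011 λ
    { s000 _ → ⊑-by-decision ; s001 → ⊥-elim ∘ ¬r001 ; s010 → ⊥-elim ∘ ¬r010 ; s011 _ → ⊑-refl ; s012 → ⊥-elim ∘ ¬r012 })
  ...   | no ¬r001 | no ¬r010 | no ¬r011 with holds? R (const 0)
  ...     | no ¬r000 = inj₂ (empty (empty-unless-constant R ¬r000))
  ...     | yes r000 = inj₂ (generated-by-shape R s000 r000 λ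
    { s000 _ → ⊑-refl ; s001 → ⊥-elim ∘ ¬r001 ; s010 → ⊥-elim ∘ ¬r010 ; s011 → ⊥-elim ∘ ¬r011 ; s012 → ⊥-elim ∘ ¬r012 })

  dichotomy : ∀ n → DichotomyAt n
  dichotomy 0 R _ = inj₂ (principal-of-arity≤1 (λ ()) R)
  dichotomy 1 R _ = inj₂ (principal-of-arity≤1 (λ { zero zero → refl }) R)
  dichotomy 2 R _ = inj₂ (principal₂ R)
  dichotomy 3 = ternary
  dichotomy (suc (suc (suc (suc n)))) = step (dichotomy (suc (suc (suc n))))

-- Defining x = y ∨ u = v from a selector

OrEqBySelector : UpRel 3 → (x y u v : ℕ) → Set
OrEqBySelector T x y u v =
  ∃ λ a → ∀ b → ∃ λ c → holds T ⟨ x , c , a ⟩ × holds T ⟨ y , c , a ⟩ × holds T ⟨ u , b , c ⟩ × holds T ⟨ v , b , c ⟩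

module _ {T : UpRel 3} (selector : IsSelector T) where
  open IsSelector selector

  selects-first : ∀ p q → holds T ⟨ p , q , p ⟩
  selects-first p q = mono T (⊑³ (λ ()) (λ _ → refl) (λ ())) holds-010

  selects-second : ∀ p q → holds T ⟨ p , q , q ⟩
  selects-second p q = mono T (⊑³ (λ ()) (λ ()) (λ _ → refl)) holds-011

  selects-input : ∀ {p q r} → p ≢ q → holds T ⟨ p , q , r ⟩ → r ≡ p ⊎ r ≡ q
  selects-input {p} {q} {r} p≢q t with r ℕ.≟ p | r ℕ.≟ q
  ... | yes r≡p | _ = inj₁ r≡p
  ... | no _ | yes r≡q = inj₂ r≡q
  ... | no r≢p | no r≢q =
    contradiction (mono T (⊑³ (⊥-elim ∘ p≢q) (⊥-elim ∘ r≢p ∘ sym) (⊥-elim ∘ r≢q ∘ sym)) t) ¬holds-012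

  private
    input-other-than : ∀ {p q r} → p ≢ q → r ≢ q → holds T ⟨ p , q , r ⟩ → r ≡ p
    input-other-than p≢q r≢q t = fromInj₁ (λ r≡q → contradiction r≡q r≢q) (selects-input p≢q t)

    orEq-from-fresh : ∀ {x y u v a b c} → x ≢ b → y ≢ b → u ≢ b → v ≢ b → a ≢ b →
                      holds T ⟨ x , c , a ⟩ → holds T ⟨ y , c , a ⟩ → holds T ⟨ u , b , c ⟩ → holds T ⟨ v , b , c ⟩ →
                      x ≡ y ⊎ u ≡ v
    orEq-from-fresh {b = b} {c} x≢b y≢b u≢b v≢b a≢b txa tya tub tvb with c ℕ.≟ b
    ... | yes refl = inj₁ (trans (sym (input-other-than x≢b a≢b txa)) (input-other-than y≢b a≢b tya))
    ... | no c≢b = inj₂ (trans (sym (input-other-than u≢b c≢b tub)) (input-other-than v≢b c≢b tvb))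

  -- Reading T(p,q,r) as r ∈ {p, q}: for fresh b, either c = b, which forces a = x and a = y,
  -- or c ≠ b, which forces c = u and c = v.
  orEq⇔orEqBySelector : ∀ {x y u v} → (x ≡ y ⊎ u ≡ v) ⇔ OrEqBySelector T x y u v
  orEq⇔orEqBySelector {x} {y} {u} {v} = mk⇔ to from
    where
      to : x ≡ y ⊎ u ≡ v → OrEqBySelector T x y u v
      to (inj₁ refl) = x , λ b → b , selects-first x b , selects-first x b , selects-second u b , selects-second v b
      to (inj₂ refl) = u , λ b → u , selects-second x u , selects-second y u , selects-first u b , selects-first u b

      from : OrEqBySelector T x y u v → x ≡ y ⊎ u ≡ v
      from (a , f) =
        let vals = lookup (x ∷ y ∷ u ∷ v ∷ a ∷ [])
            c , txa , tya , tub , tvb = f (fresh vals)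
        in orEq-from-fresh (fresh-≢ vals (# 0)) (fresh-≢ vals (# 1)) (fresh-≢ vals (# 2)) (fresh-≢ vals (# 3))
                           (fresh-≢ vals (# 4)) txa tya tub tvb

module Expressibility (Γ : Language) where

  Expressible : (Tuple n → Set) → Set
  Expressible {n} Q = ∀ {K} (ρ : Fin n → Fin K) → Σ (QCF Γ K) λ φ → ∀ a → ⟦ φ ⟧Q a ⇔ Q (a ∘ ρ)

  Definable : UpRel n → Set
  Definable R = Expressible (holds R)

  reindex-definable : ∀ {m n} (μ : Fin m → Fin n) {R : UpRel m} → Definable R → Definable (reindex μ R)
  reindex-definable μ d ρ = d (ρ ∘ μ)

  -- the quantified variable becomes de Bruijn index zero, i.e. coordinate k of R
  shift-insertAt : ∀ {K} (ρ : Fin n → Fin K) (k : Fin (suc n)) (a : Fin K → ℕ) (x : ℕ) →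
                   extend x a ∘ insertAt (suc ∘ ρ) k zero ≗ insertAt (a ∘ ρ) k x
  shift-insertAt ρ k a x = map-insertAt (extend x a) (suc ∘ ρ) k zero

  project∃-definable : ∀ {n} (k : Fin (suc n)) {R : UpRel (suc n)} → Definable R → Definable (project∃ k R)
  project∃-definable k {R} d ρ with d (insertAt (suc ∘ ρ) k zero)
  ... | φ , φ⇔R = ex φ , λ a → mk⇔
    (λ (x , sat) → x , holds-≗ R (shift-insertAt ρ k a x) (Equivalence.to (φ⇔R (extend x a)) sat))
    (λ (x , r) → x , Equivalence.from (φ⇔R (extend x a)) (holds-≗ R (sym ∘ shift-insertAt ρ k a x) r))

  project∀-definable : ∀ {n} (k : Fin (suc n)) {R : UpRel (suc n)} → Definable R → Definable (project∀ k R)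
  project∀-definable k {R} d ρ with d (insertAt (suc ∘ ρ) k zero)
  ... | φ , φ⇔R = all φ , λ a → mk⇔
    (λ sat x → holds-≗ R (shift-insertAt ρ k a x) (Equivalence.to (φ⇔R (extend x a)) (sat x)))
    (λ r x → Equivalence.from (φ⇔R (extend x a)) (holds-≗ R (sym ∘ shift-insertAt ρ k a x) (r x)))

  open Dichotomy Definable reindex-definable project∃-definable project∀-definable public

  module _ (T : UpRel 3) (d : Definable T) where

    T⟨_,_,_⟩ : ∀ {K} → Fin K → Fin K → Fin K → QCF Γ K
    T⟨ x , y , z ⟩ = proj₁ (d ⟨ x , y , z ⟩)

    T⟨⟩-⇔ : ∀ {K} (x y z : Fin K) (e : Fin K → ℕ) → ⟦ T⟨ x , y , z ⟩ ⟧Q e ⇔ holds T ⟨ e x , e y , e z ⟩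
    T⟨⟩-⇔ x y z e = ⇔-trans (proj₂ (d ⟨ x , y , z ⟩) e) (holds-⇔ T (∘-⟨⟩ e x y z))

    -- de Bruijn indices 0, 1, 2 are c, b, a and 3, …, 6 are the free variables x, y, u, v
    orEq-formula : QCF Γ 4
    orEq-formula = ex (all (ex (T⟨ # 3 , # 0 , # 2 ⟩ ∧ (T⟨ # 4 , # 0 , # 2 ⟩ ∧ (T⟨ # 5 , # 1 , # 0 ⟩ ∧ T⟨ # 6 , # 1 , # 0 ⟩)))))

    orEq-formula-⇔ : ∀ w → ⟦ orEq-formula ⟧Q w ⇔ OrEqBySelector T (w (# 0)) (w (# 1)) (w (# 2)) (w (# 3))
    orEq-formula-⇔ w = mk⇔
      (map₂ λ f b → map₂ (λ (t₁ , t₂ , t₃ , t₄) → to (⇔₁ _) t₁ , to (⇔₂ _) t₂ , to (⇔₃ _) t₃ , to (⇔₄ _) t₄) (f b))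
      (map₂ λ f b → map₂ (λ (t₁ , t₂ , t₃ , t₄) → from (⇔₁ _) t₁ , from (⇔₂ _) t₂ , from (⇔₃ _) t₃ , from (⇔₄ _) t₄) (f b))
      where
        open Equivalence
        ⇔₁ = T⟨⟩-⇔ (# 3) (# 0) (# 2)
        ⇔₂ = T⟨⟩-⇔ (# 4) (# 0) (# 2)
        ⇔₃ = T⟨⟩-⇔ (# 5) (# 1) (# 0)
        ⇔₄ = T⟨⟩-⇔ (# 6) (# 1) (# 0)

positive-clause-mono : {c : Clause n} → All IsEqLit c → a ⊑ b → ⟦ c ⟧C a → ⟦ c ⟧C b
positive-clause-mono ((i , j , refl) ∷ _) a⊑b (here e) = here (a⊑b i j e)
positive-clause-mono (_ ∷ pos) a⊑b (there sat) = there (positive-clause-mono pos a⊑b sat)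

positive-cnf-mono : {φ : CNF n} → PositiveCNF φ → a ⊑ b → ⟦ φ ⟧CNF a → ⟦ φ ⟧CNF b
positive-cnf-mono [] a⊑b [] = []
positive-cnf-mono (pos ∷ poss) a⊑b (sat ∷ sats) = positive-clause-mono pos a⊑b sat ∷ positive-cnf-mono poss a⊑b sats

literal? : (l : Literal n) → Decidable ⟦ l ⟧L
literal? (eqL i j) a = a i ℕ.≟ a j
literal? (neqL i j) a = ¬? (a i ℕ.≟ a j)

cnf? : (φ : CNF n) → Decidable ⟦ φ ⟧CNF
cnf? φ a = All.all? (λ c → Any.any? (λ l → literal? l a) c) φ

positive⇒upRel : {Q : Rel n} → PositiveRel Q → UpRel n
positive⇒upRel {Q = Q} (φ , pos , φ⇔Q) = record
  { holds  = Q
  ; mono   = λ {a} {b} a⊑b → to (φ⇔Q b) ∘ positive-cnf-mono pos a⊑b ∘ from (φ⇔Q a)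
  ; holds? = λ a → map′ (to (φ⇔Q a)) (from (φ⇔Q a)) (cnf? φ a)
  }
  where open Equivalence

-- x_i = x_j where g_i = g_j, and the trivial x_i = x_i elsewhere
kernel-partner : Tuple n → Fin n → Fin n → Fin n
kernel-partner g i j with g i ℕ.≟ g j
... | yes _ = j
... | no _ = i

kernel-partner-⇔ : (g : Tuple n) (i j : Fin n) → b i ≡ b (kernel-partner g i j) ⇔ (g i ≡ g j → b i ≡ b j)
kernel-partner-⇔ g i j with g i ℕ.≟ g j
... | yes gi≡gj = mk⇔ const (_$ gi≡gj)
... | no gi≢gj = mk⇔ (λ _ gi≡gj → contradiction gi≡gj gi≢gj) (λ _ → refl)

kernel-cnf : Tuple n → CNF n
kernel-cnf g = concat (tabulate λ i → tabulate λ j → [ eqL i (kernel-partner g i j) ])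

kernel-cnf-negative : (g : Tuple n) → NegativeCNF (kernel-cnf g)
kernel-cnf-negative g = concat⁺ (tabulate⁺ λ i → tabulate⁺ λ j → inj₁ (i , _ , refl))

kernel-cnf-⇔ : (g : Tuple n) → ⟦ kernel-cnf g ⟧CNF b ⇔ g ⊑ b
kernel-cnf-⇔ g = mk⇔
  (λ sat i j → to (kernel-partner-⇔ g i j) (singleton⁻ (tabulate⁻ (tabulate⁻ (concat⁻ sat) i) j)))
  (λ g⊑b → concat⁺ (tabulate⁺ λ i → tabulate⁺ λ j → here (from (kernel-partner-⇔ g i j) (g⊑b i j))))
  where open Equivalence

principal⇒negative : (R : UpRel n) → Principal R → NegativeRel (holds R)
principal⇒negative R (empty none) = [ [] ] , inj₂ [] ∷ [] , λ a → mk⇔ (λ { (() ∷ []) }) (λ r → contradiction r (none a))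
principal⇒negative R (generated g rg least) = kernel-cnf g , kernel-cnf-negative g , λ a → mk⇔
  (λ sat → mono R (Equivalence.to (kernel-cnf-⇔ g) sat) rg) (Equivalence.from (kernel-cnf-⇔ g) ∘ least)

first-or-all : ∀ {ℓ₁ ℓ₂} {A : Set ℓ₁} {B : Fin n → Set ℓ₂} → (∀ i → A ⊎ B i) → A ⊎ (∀ i → B i)
first-or-all {zero} _ = inj₂ λ ()
first-or-all {suc n} f with f zero | first-or-all (f ∘ suc)
... | inj₁ a | _ = inj₁ a
... | inj₂ _ | inj₁ a = inj₁ a
... | inj₂ b₀ | inj₂ bs = inj₂ (∀-cons b₀ bs)

module _ (Γ : Language) where
  open Expressibility Γ

  selector⇒orEq-definable : Selector → QCFDefinable Γ OrEq
  selector⇒orEq-definable (T , d , selector) =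
    orEq-formula T d , λ w → ⇔-trans (orEq-formula-⇔ T d w) (⇔-sym (orEq⇔orEqBySelector selector))

  module _ (positive : PositiveLang Γ) where

    base : (r : Fin (length Γ)) → UpRel (arity Γ r)
    base r = positive⇒upRel (All.lookup positive (∈-lookup r))

    base-definable : (r : Fin (length Γ)) → Definable (base r)
    base-definable r ρ = atom r ρ , λ _ → mk⇔ id id

    all-principal⇒negative : (∀ r → Principal (base r)) → NegativeLang Γ
    all-principal⇒negative principal =
      subst (All _) (tabulate-lookup Γ) (tabulate⁺ λ r → principal⇒negative (base r) (principal r))

    selector-or-negative : Selector ⊎ NegativeLang Γ
    selector-or-negative =
      Sum.map₂ all-principal⇒negative (first-or-all λ r → dichotomy _ (base r) (base-definable r))

mainTheorem17 : (Γ : Language) → IsEqualityLanguage Γ → PositiveLang Γ → ¬ NegativeLang Γ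
    → QCFDefinable Γ OrEq
mainTheorem17 Γ _ positive ¬negative with selector-or-negative Γ positive
... | inj₁ selector = selector⇒orEq-definable Γ selector
... | inj₂ negative = contradiction negative ¬negative
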